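{- For each natural number $n\geq1$, let $a_1,\dots,a_{n+1}$ be $n+1$ pairwise different letters and $L_{9,n}=\{a_1\}^+\{a_2\}^+\cdots\{a_{n+1}\}^+$. Then $L_{9,n}\in\mathrm{SLT}_2\setminus\mathrm{RL}_n^V$ for every $n\geq1$.
   Context: A right-linear grammar is $(N,T,P,S)$ with rules of the form $A\to wB$ or $A\to w$, $A,B\in N$, $w\in T^*$; $\mathrm{RL}_n^V$ is the family of regular languages generated by some right-linear grammar with at most $n$ non-terminal symbols. For $k\geq1$, a language $L$ over an alphabet $V$ is strictly locally $k$-testable (family $\mathrm{SLT}_k$) if there are sets $B,I,E\subseteq V^k$ and a finite set $F$ of words of length at most $k-1$ such that $L$ consists of the words of $F$ together with exactly those words $b_1b_2\cdots b_m$ ($m\geq k$, $b_i\in V$) for which $b_1\cdots b_k\in B$, $b_{j+1}\cdots b_{j+k}\in I$ for every $j$ with $1\leq j\leq m-k-1$, and $b_{m-k+1}\cdots b_m\in E$. -}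

module Defs where

open import Level using (0ℓ)
open import Data.Nat using (ℕ; zero; suc; _≤_; _<_; _∸_)
open import Data.Fin using (Fin)
open import Data.List using (List; []; _∷_; _++_; length; drop; replicate; concatMap; allFin)
open import Data.List.Relation.Unary.All using (All)
open import Data.List.Membership.Propositional using (_∈_)
open import Data.Vec using (Vec; []; _∷_)
open import Data.Maybe using (Maybe; just; nothing)
open import Data.Product using (Σ; ∃; _×_; _,_)
open import Data.Sum using (_⊎_)
open import Relation.Binary.PropositionalEquality using (_≡_)
open import Function.Bundles using (_⇔_)

Language : Set → Set₁
Language A = List A → Set

-- Right-linear grammars with m nonterminals (Fin m) and terminals in A.
-- A rule (X , w , just Y) is  X → w Y ;  a rule (X , w , nothing) is  X → w.

record RLGrammar (A : Set) (m : ℕ) : Set where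
  field
    rules : List (Fin m × List A × Maybe (Fin m))
    start : Fin m

open RLGrammar public

data Derives {A : Set} {m : ℕ} (G : RLGrammar A m) : Fin m → List A → Set where
  term : ∀ {X u} → (X , u , nothing) ∈ rules G → Derives G X u
  step : ∀ {X Y u v} → (X , u , just Y) ∈ rules G → Derives G Y v →
         Derives G X (u ++ v)

LangOf : {A : Set} {m : ℕ} → RLGrammar A m → Language A
LangOf G = Derives G (start G)

RL : {A : Set} → ℕ → Language A → Set
RL {A} n L = Σ ℕ λ m → m ≤ n × Σ (RLGrammar A m) λ G → ∀ w → L w ⇔ LangOf G w

takeVec : {A : Set} (k : ℕ) → List A → Maybe (Vec A k)
takeVec zero    _        = just []
takeVec (suc k) []       = nothing
takeVec (suc k) (x ∷ xs) with takeVec k xs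
... | just v  = just (x ∷ v)
... | nothing = nothing

-- Factor k w j v : the factor of length k of w starting at (0-based) position j is v
Factor : {A : Set} (k : ℕ) → List A → ℕ → Vec A k → Set
Factor k w j v = takeVec k (drop j w) ≡ just v

-- The condition on words b₁⋯bₘ with m ≥ k (positions 1-based in the paper,
-- 0-based here): b₁⋯b_k ∈ B; b_{j+1}⋯b_{j+k} ∈ I for 1 ≤ j ≤ m-k-1;
-- b_{m-k+1}⋯bₘ ∈ E.
SLTCond : {A : Set} (k : ℕ) (B I E : Vec A k → Set) → List A → Set
SLTCond k B I E w =
  k ≤ length w
  × (∃ λ v → Factor k w 0 v × B v)
  × (∀ j → 1 ≤ j → j ≤ length w ∸ k ∸ 1 → ∃ λ v → Factor k w j v × I v)
  × (∃ λ v → Factor k w (length w ∸ k) v × E v)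

SLT : {A : Set} → ℕ → Language A → Set₁
SLT {A} k L =
  Σ (Vec A k → Set) λ B → Σ (Vec A k → Set) λ I → Σ (Vec A k → Set) λ E →
  Σ (List (List A)) λ F →
    All (λ u → length u < k) F
    × (∀ w → L w ⇔ (w ∈ F ⊎ SLTCond k B I E w))

L9 : {A : Set} (n : ℕ) → (Fin (suc n) → A) → Language A
L9 n a w = Σ (Fin (suc n) → ℕ) λ p →
  w ≡ concatMap (λ i → replicate (suc (p i)) (a i)) (allFin (suc n))

-- A word lies in L_{9,n} iff it starts with a₁, ends with a_{n+1} and each of its 2-factors
-- is aᵢaᵢ or aᵢaᵢ₊₁; this is a description by allowed initial, inner and final 2-factors.
-- For the lower bound, let G have at most n nonterminals and let N exceed the total length of
-- the right-hand sides of G. A derivation of w = a₁^N ⋯ a_{n+1}^N cannot jump over a run of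
-- N letters, so it passes through a nonterminal inside each of the n+1 runs. Two runs i < j
-- share a nonterminal, and splicing the derivation there produces a word of L(G) containing
-- the factor aⱼaᵢ, which no word of L_{9,n} has.
module Submission where

open import Defs
open import Data.Nat using (ℕ; zero; suc; _+_; _∸_; _≤_; _<_; z≤n; s≤s)
open import Data.Nat.Properties
  using (≤-refl; ≤-trans; ≤-reflexive; ≤-antisym; ≰⇒>; _≤?_; m≤m+n; m≤n+m; m∸n≤m; ≤-<-trans; <-irrefl; ≤⇒≯)
open import Data.Nat.ListAction using (sum)
open import Data.Fin using (Fin; zero; suc; fromℕ)
import Data.Fin as Fin
open import Data.Fin.Properties using (suc-injective; pigeonhole)
open import Data.List
  using (List; []; _∷_; _++_; length; replicate; concat; concatMap; map; tabulate; allFin; head; last)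
open import Data.List.Properties
  using (map-tabulate; ++-assoc; ++-identityʳ; ∷-injective; length-replicate; length-++-≤ˡ; length-++-≤ʳ)
open import Data.List.Membership.Propositional using (_∈_)
open import Data.List.Membership.Propositional.Properties using (∈-allFin; ∈-map⁺)
open import Data.List.Relation.Unary.Any using (here; there)
open import Data.List.Relation.Unary.All using ([])
open import Data.List.Relation.Unary.Linked using (Linked; []; [-]; _∷_)
import Data.List.Relation.Unary.Linked as Linked
open import Data.Vec using (Vec; []; _∷_)
open import Data.Vec.Functional using () renaming (_∷_ to _◂_)
open import Data.Maybe using (just)
open import Data.Maybe.Properties using (just-injective)
open import Data.Product using (∃; ∃₂; _×_; _,_; proj₁; proj₂)
open import Data.Sum using (_⊎_; inj₁; inj₂)
open import Data.Empty using (⊥-elim)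
open import Relation.Nullary using (¬_; yes; no)
open import Relation.Binary.PropositionalEquality using (_≡_; _≢_; refl; sym; trans; cong; subst)
open import Function using (_∘_)
open import Function.Definitions using (Injective)
open import Function.Bundles using (_⇔_; mk⇔; Equivalence)
open import Function.Construct.Composition using (_⇔-∘_)

module _ {A : Set} where

  last-++ : ∀ xs {ys : List A} {y} → last ys ≡ just y → last (xs ++ ys) ≡ just y
  last-++ []            e = e
  last-++ (x ∷ [])      {_ ∷ _} e = e
  last-++ (x ∷ x′ ∷ xs) e = last-++ (x′ ∷ xs) e

  last-replicate : ∀ n (x : A) → last (replicate (suc n) x) ≡ just x
  last-replicate zero    x = refl
  last-replicate (suc n) x = last-replicate n x

  ++-≡-++-split : ∀ (u v x y : List A) → u ++ v ≡ x ++ y →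
    (∃ λ x′ → x ≡ u ++ x′ × v ≡ x′ ++ y) ⊎ (∃₂ λ h u′ → u ≡ x ++ h ∷ u′ × y ≡ h ∷ u′ ++ v)
  ++-≡-++-split []      v x       y eq = inj₁ (x , refl , eq)
  ++-≡-++-split (h ∷ u) v []      y eq = inj₂ (h , u , refl , sym eq)
  ++-≡-++-split (h ∷ u) v (_ ∷ x) y eq with refl , eq′ ← ∷-injective eq
    with ++-≡-++-split u v x y eq′
  ... | inj₁ (x′ , ex , ev)      = inj₁ (x′ , cong (h ∷_) ex , ev)
  ... | inj₂ (k , u′ , eu , ey) = inj₂ (k , u′ , cong (h ∷_) eu , ey)

  replicate-++-split : ∀ N (c : A) z l v → replicate N c ++ z ≡ l ++ v → length l < N →
    l ≡ replicate (length l) c × ∃ λ t → v ≡ replicate (suc t) c ++ z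
  replicate-++-split (suc N) c z []      v eq _ = refl , N , sym eq
  replicate-++-split (suc N) c z (h ∷ l) v eq (s≤s lt) with refl , eq′ ← ∷-injective eq
    with el , t , ev ← replicate-++-split N c z l v eq′ lt = cong (c ∷_) el , t , ev

  infix-length : ∀ (x y z : List A) → length y ≤ length (x ++ y ++ z)
  infix-length x y z = ≤-trans (length-++-≤ˡ y) (length-++-≤ʳ (y ++ z) {x})

  concatMap-infix : {B : Set} (h : B → List A) {i : B} {xs : List B} → i ∈ xs →
    ∃₂ λ x z → concatMap h xs ≡ x ++ h i ++ z
  concatMap-infix h {xs = y ∷ xs} (here refl) = [] , concatMap h xs , refl
  concatMap-infix h {xs = y ∷ xs} (there i∈xs) with x , z , eq ← concatMap-infix h i∈xs =
    h y ++ x , z , trans (cong (h y ++_) eq) (sym (++-assoc (h y) x _))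

  Linked-replicate-++ : {P : A → A → Set} (c : ℕ) {x : A} {rest : List A} → P x x →
    Linked P (x ∷ rest) → Linked P (replicate (suc c) x ++ rest)
  Linked-replicate-++ zero    pxx l = l
  Linked-replicate-++ (suc c) pxx l = pxx ∷ Linked-replicate-++ c pxx l

  Linked-junction : {P : A → A → Set} (xs : List A) {ys : List A} {x y : A} →
    last xs ≡ just x → head ys ≡ just y → Linked P (xs ++ ys) → P x y
  Linked-junction (_ ∷ [])      {_ ∷ _} refl refl (p ∷ _) = p
  Linked-junction (_ ∷ x′ ∷ xs) ex ey l = Linked-junction (x′ ∷ xs) ex ey (Linked.tail l)

∈⇒≤sum : ∀ {n ns} → n ∈ ns → n ≤ sum ns
∈⇒≤sum {ns = n ∷ ns} (here refl)  = m≤m+n n (sum ns)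
∈⇒≤sum {ns = m ∷ ns} (there n∈ns) = ≤-trans (∈⇒≤sum n∈ns) (m≤n+m (sum ns) m)

OnPair : {A : Set} → (A → A → Set) → Vec A 2 → Set
OnPair P (x ∷ y ∷ []) = P x y

Chain : {A : Set} → (A → A → Set) → A → A → Language A
Chain P s t w = head w ≡ just s × last w ≡ just t × Linked P w

module _ {A : Set} where

  factor₂ : (w : List A) (j : ℕ) → 2 + j ≤ length w → ∃₂ λ x y → Factor 2 w j (x ∷ y ∷ [])
  factor₂ (x ∷ y ∷ w) zero    _        = x , y , refl
  factor₂ (x ∷ w)     (suc j) (s≤s le) = factor₂ w j le

  Linked⇒factor₂ : {P : A → A → Set} {w : List A} (j : ℕ) {x y : A} →
    Linked P w → Factor 2 w j (x ∷ y ∷ []) → P x y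
  Linked⇒factor₂ {w = _ ∷ _ ∷ _} zero    (p ∷ _) refl = p
  Linked⇒factor₂ {w = _ ∷ _}     (suc j) l       f    = Linked⇒factor₂ j (Linked.tail l) f

  factors₂⇒Linked : {P : A → A → Set} (w : List A) →
    (∀ j → 2 + j ≤ length w → ∃ λ v → Factor 2 w j v × OnPair P v) → Linked P w
  factors₂⇒Linked         []          _ = []
  factors₂⇒Linked         (x ∷ [])    _ = [-]
  factors₂⇒Linked {P = P} (x ∷ y ∷ w) h =
    first (h zero (s≤s (s≤s z≤n))) ∷ factors₂⇒Linked (y ∷ w) (λ j le → h (suc j) (s≤s le))
    where
    first : (∃ λ v → Factor 2 (x ∷ y ∷ w) 0 v × OnPair P v) → P x y
    first (_ , refl , pxy) = pxy

  lastFactor₂ : (w : List A) {x y : A} → Factor 2 w (length w ∸ 2) (x ∷ y ∷ []) → last w ≡ just y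
  lastFactor₂ (x ∷ y ∷ [])    refl = refl
  lastFactor₂ (x ∷ y ∷ z ∷ w) f    = lastFactor₂ (y ∷ z ∷ w) f

Chain-SLT₂ : {A : Set} {P : A → A → Set} {s t : A} → s ≢ t → SLT 2 (Chain P s t)
Chain-SLT₂ {A} {P} {s} {t} s≢t =
  B , I , E , [] , [] , λ w → mk⇔ (inj₂ ∘ to w) λ { (inj₁ ()) ; (inj₂ c) → from w c }
  where
  B I E : Vec A 2 → Set
  B = OnPair λ x y → x ≡ s × P x y
  I = OnPair P
  E = OnPair λ x y → y ≡ t × P x y

  to : ∀ w → Chain P s t w → SLTCond 2 B I E w
  to (x ∷ [])        (refl , e , _) = ⊥-elim (s≢t (just-injective e))
  to w@(x ∷ y ∷ r) (refl , e , l@(p ∷ _)) = s≤s (s≤s z≤n) , (_ , refl , refl , p) , inner , final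
    where
    inner : ∀ j → 1 ≤ j → j ≤ length r ∸ 1 → ∃ λ v → Factor 2 w j v × I v
    inner j _ le with _ , _ , f ← factor₂ w j (s≤s (s≤s (≤-trans le (m∸n≤m (length r) 1)))) =
      _ , f , Linked⇒factor₂ j l f
    final : ∃ λ v → Factor 2 w (length r) v × E v
    final with _ , _ , f ← factor₂ w (length r) ≤-refl =
      _ , f , just-injective (trans (sym (lastFactor₂ w f)) e) , Linked⇒factor₂ (length r) l f

  from : ∀ w → SLTCond 2 B I E w → Chain P s t w
  from (x ∷ [])        (s≤s () , _)
  from w@(x ∷ y ∷ r) (_ , (_ , refl , refl , pxy) , inner , ((_ ∷ _ ∷ []) , fe , refl , pe)) =
    refl , lastFactor₂ w fe , factors₂⇒Linked w factor
    where
    last-position : ∀ {j} L → suc j ≤ L → ¬ suc j ≤ L ∸ 1 → suc j ≡ L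
    last-position (suc L) le ¬inner = ≤-antisym le (≰⇒> ¬inner)
    factor : ∀ j → 2 + j ≤ length w → ∃ λ v → Factor 2 w j v × I v
    factor zero    _                = _ , refl , pxy
    factor (suc j) (s≤s (s≤s le)) with suc j ≤? length r ∸ 1
    ... | yes in-range = inner (suc j) (s≤s z≤n) in-range
    ... | no ¬in-range =
      _ , subst (λ k → Factor 2 w k _) (sym (last-position (length r) le ¬in-range)) fe , pe

SLT-cong : {A : Set} {k : ℕ} {L M : Language A} → (∀ w → L w ⇔ M w) → SLT k M → SLT k L
SLT-cong L⇔M (B , I , E , F , short , M⇔) = B , I , E , F , short , λ w → M⇔ w ⇔-∘ L⇔M w

-- x = b i and y ∈ {b i, b (i + 1)}: the 2-factors of the words b₀⁺ ⋯ bₘ⁺.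
Adjacent : {A : Set} (m : ℕ) → (Fin (suc m) → A) → A → A → Set
Adjacent zero    b x y = x ≡ b zero × y ≡ b zero
Adjacent (suc m) b x y = (x ≡ b zero × (y ≡ b zero ⊎ y ≡ b (suc zero))) ⊎ Adjacent m (b ∘ suc) x y

blocks : {A : Set} (m : ℕ) → (Fin (suc m) → A) → (Fin (suc m) → ℕ) → List A
blocks m b p = concat (tabulate λ i → replicate (suc (p i)) (b i))

module _ {A : Set} where

  adjacent-ascending : (m : ℕ) (b : Fin (suc m) → A) {x y : A} → Adjacent m b x y →
    ∃₂ λ i j → x ≡ b i × y ≡ b j × i Fin.≤ j
  adjacent-ascending zero    b (ex , ey)                = zero , zero , ex , ey , z≤n
  adjacent-ascending (suc m) b (inj₁ (ex , inj₁ ey)) = zero , zero , ex , ey , z≤n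
  adjacent-ascending (suc m) b (inj₁ (ex , inj₂ ey)) = zero , suc zero , ex , ey , z≤n
  adjacent-ascending (suc m) b (inj₂ r) with i , j , ex , ey , i≤j ← adjacent-ascending m (b ∘ suc) r =
    suc i , suc j , ex , ey , s≤s i≤j

  adjacent⇒≤ : (m : ℕ) (b : Fin (suc m) → A) → Injective _≡_ _≡_ b →
    ∀ {i j} → Adjacent m b (b i) (b j) → i Fin.≤ j
  adjacent⇒≤ m b inj r with _ , _ , ei , ej , i≤j ← adjacent-ascending m b r
    with refl ← inj ei | refl ← inj ej = i≤j

  blocks-last : (m : ℕ) (b : Fin (suc m) → A) (p : Fin (suc m) → ℕ) →
    last (blocks m b p) ≡ just (b (fromℕ m))
  blocks-last zero    b p rewrite ++-identityʳ (replicate (suc (p zero)) (b zero)) = last-replicate (p zero) (b zero)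
  blocks-last (suc m) b p = last-++ (replicate (suc (p zero)) (b zero)) (blocks-last m (b ∘ suc) (p ∘ suc))

  blocks-Linked : (m : ℕ) (b : Fin (suc m) → A) (p : Fin (suc m) → ℕ) →
    Linked (Adjacent m b) (blocks m b p)
  blocks-Linked zero    b p = Linked-replicate-++ (p zero) (refl , refl) [-]
  blocks-Linked (suc m) b p = Linked-replicate-++ (p zero) (inj₁ (refl , inj₁ refl))
    (inj₁ (refl , inj₂ refl) ∷ Linked.map inj₂ (blocks-Linked m (b ∘ suc) (p ∘ suc)))

  blocks-Chain : (m : ℕ) (b : Fin (suc m) → A) (p : Fin (suc m) → ℕ) →
    Chain (Adjacent m b) (b zero) (b (fromℕ m)) (blocks m b p)
  blocks-Chain m b p = refl , blocks-last m b p , blocks-Linked m b p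

  blocks-∷ : (m : ℕ) (b : Fin (suc m) → A) {w : List A} →
    (∃ λ p → b zero ∷ w ≡ blocks m b p) → ∃ λ p → b zero ∷ b zero ∷ w ≡ blocks m b p
  blocks-∷ m b (p , eq) = (suc (p zero) ◂ p ∘ suc) , cong (b zero ∷_) eq

  Linked-Adjacent-suc : (m : ℕ) (b : Fin (suc (suc m)) → A) → Injective _≡_ _≡_ b →
    ∀ k xs → Linked (Adjacent (suc m) b) (b (suc k) ∷ xs) →
    Linked (Adjacent m (b ∘ suc)) (b (suc k) ∷ xs)
  Linked-Adjacent-suc m b inj k []       _                  = [-]
  Linked-Adjacent-suc m b inj k (_ ∷ xs) (inj₁ (e , _) ∷ l) with () ← inj e
  Linked-Adjacent-suc m b inj k (_ ∷ xs) (inj₂ r ∷ l)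
    with _ , j , _ , refl , _ ← adjacent-ascending m (b ∘ suc) r = r ∷ Linked-Adjacent-suc m b inj j xs l

  Linked⇒blocks : (m : ℕ) (b : Fin (suc m) → A) → Injective _≡_ _≡_ b → ∀ w →
    Linked (Adjacent m b) (b zero ∷ w) → last (b zero ∷ w) ≡ just (b (fromℕ m)) →
    ∃ λ p → b zero ∷ w ≡ blocks m b p
  Linked⇒blocks zero    b inj []      _ _ = (λ _ → 0) , refl
  Linked⇒blocks (suc m) b inj []      _ e with () ← inj (just-injective e)
  Linked⇒blocks zero    b inj (_ ∷ w) ((_ , refl) ∷ l) e =
    blocks-∷ zero b (Linked⇒blocks zero b inj w l e)
  Linked⇒blocks (suc m) b inj (_ ∷ w) (inj₁ (_ , inj₁ refl) ∷ l) e =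
    blocks-∷ (suc m) b (Linked⇒blocks (suc m) b inj w l e)
  Linked⇒blocks (suc m) b inj (_ ∷ w) (inj₁ (_ , inj₂ refl) ∷ l) e
    with p , eq ← Linked⇒blocks m (b ∘ suc) (suc-injective ∘ inj) w (Linked-Adjacent-suc m b inj zero w l) e
    = (0 ◂ p) , cong (b zero ∷_) eq
  Linked⇒blocks (suc m) b inj (_ ∷ w) (inj₂ r ∷ l) e
    with _ , _ , e₀ , _ ← adjacent-ascending m (b ∘ suc) r
    with () ← inj e₀

  L9⇔Chain : (n : ℕ) (a : Fin (suc n) → A) → Injective _≡_ _≡_ a →
    ∀ w → L9 n a w ⇔ Chain (Adjacent n a) (a zero) (a (fromℕ n)) w
  L9⇔Chain n a inj w = mk⇔ (to w) (from w)
    where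
    concatMap≡blocks : ∀ p → concatMap (λ i → replicate (suc (p i)) (a i)) (allFin (suc n)) ≡ blocks n a p
    concatMap≡blocks p = cong concat (map-tabulate (λ i → i) (λ i → replicate (suc (p i)) (a i)))
    to : ∀ w → L9 n a w → Chain (Adjacent n a) (a zero) (a (fromℕ n)) w
    to _ (p , refl) = subst (Chain _ _ _) (sym (concatMap≡blocks p)) (blocks-Chain n a p)
    from : ∀ w → Chain (Adjacent n a) (a zero) (a (fromℕ n)) w → L9 n a w
    from (_ ∷ r) (refl , e , l) with p , eq ← Linked⇒blocks n a inj r l e =
      p , trans eq (sym (concatMap≡blocks p))

module _ {A : Set} {m : ℕ} (G : RLGrammar A m) where

  Yields : Fin m → List A → Fin m → Set
  Yields X p Y = ∀ {v} → Derives G Y v → Derives G X (p ++ v)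

  ruleLength : ℕ
  ruleLength = sum (map (λ r → length (proj₁ (proj₂ r))) (rules G))

  rhs-length≤ : ∀ {X u r} → (X , u , r) ∈ rules G → length u ≤ ruleLength
  rhs-length≤ mem = ∈⇒≤sum (∈-map⁺ (λ r → length (proj₁ (proj₂ r))) mem)

  record Pause (X : Fin m) (x : List A) (c : A) (z : List A) : Set where
    field
      state          : Fin m
      {before after} : ℕ
      reach          : Yields X (x ++ replicate (suc before) c) state
      rest           : Derives G state (replicate (suc after) c ++ z)

  pause-in-run : ∀ {X w} → Derives G X w → ∀ x c N z → ruleLength < N → w ≡ x ++ replicate N c ++ z →
    Pause X x c z
  pause-in-run (term mem) x c N z long refl = ⊥-elim (<-irrefl refl (≤-<-trans run≤rule long))
    where
    run≤rule : N ≤ ruleLength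
    run≤rule = ≤-trans (≤-reflexive (sym (length-replicate N)))
                       (≤-trans (infix-length x (replicate N c) z) (rhs-length≤ mem))
  pause-in-run (step {u = u} {v} mem d) x c N z long eq with ++-≡-++-split u v x (replicate N c ++ z) eq
  ... | inj₁ (x′ , refl , ev) =
    record { state = Pause.state later
           ; reach = λ d′ → subst (Derives G _) (reassoc _ _) (step mem (Pause.reach later d′))
           ; rest  = Pause.rest later }
    where
    later : Pause _ x′ c z
    later = pause-in-run d x′ c N z long ev
    reassoc : ∀ q v′ → u ++ (x′ ++ q) ++ v′ ≡ ((u ++ x′) ++ q) ++ v′
    reassoc q v′ = trans (sym (++-assoc u _ v′)) (cong (_++ v′) (sym (++-assoc u x′ q)))
  -- the right-hand side u is shorter than the run, so the run continues past it
  ... | inj₂ (h , u′ , refl , ey)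
    with el , t , ev ← replicate-++-split N c z (h ∷ u′) v ey
                         (≤-<-trans (≤-trans (length-++-≤ʳ (h ∷ u′) {x}) (rhs-length≤ mem)) long) =
    record { state = _ ; reach = λ d′ → subst (λ q → Derives G _ (q ++ _)) (cong (x ++_) el) (step mem d′)
           ; rest = subst (Derives G _) ev d }

L9-not-RL : (n : ℕ) {A : Set} (a : Fin (suc n) → A) → Injective _≡_ _≡_ a → ¬ RL n (L9 n a)
L9-not-RL n a inj (m , m≤n , G , L⇔G) = no-shared-state (pigeonhole (s≤s m≤n) (Pause.state ∘ pause))
  where
  run : ℕ
  run = suc (ruleLength G)
  w : List _
  w = concatMap (λ i → replicate run (a i)) (allFin (suc n))
  w∈G : Derives G (start G) w
  w∈G = Equivalence.to (L⇔G w) ((λ _ → ruleLength G) , refl)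
  split-at : ∀ i → ∃₂ λ x z → w ≡ x ++ replicate run (a i) ++ z
  split-at i = concatMap-infix (λ i → replicate run (a i)) (∈-allFin i)
  x z : Fin (suc n) → List _
  x i = proj₁ (split-at i)
  z i = proj₁ (proj₂ (split-at i))
  pause : ∀ i → Pause G (start G) (x i) (a i) (z i)
  pause i = pause-in-run G w∈G (x i) (a i) run (z i) ≤-refl (proj₂ (proj₂ (split-at i)))
  no-shared-state : ¬ ∃₂ λ i j → i Fin.< j × Pause.state (pause i) ≡ Pause.state (pause j)
  no-shared-state (i , j , i<j , same) =
    ≤⇒≯ (adjacent⇒≤ n a inj (Linked-junction prefix last-a refl spliced-Linked)) i<j
    where
    prefix suffix : List _
    prefix = x j ++ replicate (suc (Pause.before (pause j))) (a j)
    suffix = replicate (suc (Pause.after (pause i))) (a i) ++ z i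
    spliced : Derives G (start G) (prefix ++ suffix)
    spliced = Pause.reach (pause j) (subst (λ Y → Derives G Y suffix) same (Pause.rest (pause i)))
    spliced-Linked : Linked (Adjacent n a) (prefix ++ suffix)
    spliced-Linked = proj₂ (proj₂ (Equivalence.to (L9⇔Chain n a inj _) (Equivalence.from (L⇔G _) spliced)))
    last-a : last prefix ≡ just (a j)
    last-a = last-++ (x j) (last-replicate (Pause.before (pause j)) (a j))

lemma9 : (n : ℕ) → 1 ≤ n → (A : Set) → (a : Fin (suc n) → A) →
    Injective _≡_ _≡_ a →
    SLT 2 (L9 n a) × ¬ RL n (L9 n a)
lemma9 (suc n) _ A a inj =
  SLT-cong (L9⇔Chain (suc n) a inj) (Chain-SLT₂ first≢last) , L9-not-RL (suc n) a inj
  where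
  first≢last : a zero ≢ a (fromℕ (suc n))
  first≢last e with () ← inj e
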